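{- Let $D$ be a GSHDS in a finite abelian group $G$, with $v=|G|$, $k=|D|$ and $k_0$ as in the definition, and let $\chi$ be a non-principal character of $G$. If $k_0=0$ then $\chi(D)=\frac{ -1\pm\sqrt v}{2}$; if $k_0=k$ then $\chi(D)=\frac{ -1\pm\sqrt{ -v}}{2}$.
   Context: Group ring notation: for a finite abelian group $G$ (additive), $D(x)=\sum_{g\in D}x^g$, $[1]=x^0$, $G(x)=\sum_gx^g$, $D(x^n)=\sum_{g\in D}x^{ng}$, $D^{(n)}=\{ng:g\in D\}$, and $\chi(D)=\sum_{g\in D}\chi(g)$. A GSHDS in $G$ is a subset $D\subseteq G$ such that for a fixed quadratic non-residue $n_0$ modulo $\exp(G)$ (integer coprime to $\exp(G)$, not a square mod $\exp(G)$) and some integer $\lambda$: $D(x)+D(x^{n_0})=G(x)-[1]$ and $D(x)D(x^{n_0})=(k_0-\lambda)[1]+\lambda G(x)$, where $k_0=|D\cap D^{(-n_0)}|$. -}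

module Defs where

open import Level using (Level; _⊔_) renaming (suc to lsuc)
open import Algebra.Bundles using (AbelianGroup; CommutativeRing)
open import Data.Bool using (Bool; true; false; _∧_; if_then_else_)
open import Data.Nat as ℕ using (ℕ; zero; suc)
open import Data.Integer as ℤ using (ℤ; +_; -[1+_])
open import Data.Integer.Divisibility using () renaming (_∣_ to _∣ℤ_)
open import Data.Nat.Coprimality using (Coprime)
open import Data.List using (List; []; _∷_; length; filterᵇ; map; foldr)
open import Data.Bool.ListAction using (any)
open import Data.List.Relation.Unary.Any using (Any)
open import Data.List.Relation.Unary.AllPairs using (AllPairs)
open import Data.Sum using (_⊎_)
open import Data.Product using (Σ; _×_; ∃; ∃-syntax)
open import Relation.Nullary using (¬_; does)
open import Relation.Binary using (Decidable)
open import Relation.Binary.PropositionalEquality using (_≡_)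

-- Finite abelian groups: an abelian group (written multiplicatively in
-- the stdlib bundle, but we read _∙_ as the group operation "+", ε as 0)
-- with decidable equality and an exhaustive duplicate-free enumeration.

record FinAbGroup (c ℓ : Level) : Set (lsuc (c ⊔ ℓ)) where
  field
    abGroup : AbelianGroup c ℓ
  open AbelianGroup abGroup public
  field
    _≟_      : Decidable _≈_
    elems    : List Carrier
    complete : ∀ g → Any (g ≈_) elems
    distinct : AllPairs (λ a b → ¬ a ≈ b) elems

  _==_ : Carrier → Carrier → Bool
  a == b = does (a ≟ b)

  count : (Carrier → Bool) → ℕ
  count p = length (filterᵇ p elems)

  order : ℕ
  order = length elems

  _ℕ·_ : ℕ → Carrier → Carrier
  zero ℕ· g = ε
  suc n ℕ· g = g ∙ (n ℕ· g)

  _·_ : ℤ → Carrier → Carrier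
  (+ n) · g = n ℕ· g
  -[1+ n ] · g = (suc n ℕ· g) ⁻¹

  IsExponent : ℕ → Set (c ⊔ ℓ)
  IsExponent e = (0 ℕ.< e) × (∀ g → (e ℕ· g) ≈ ε)
                 × (∀ e′ → 0 ℕ.< e′ → (∀ g → (e′ ℕ· g) ≈ ε) → e ℕ.≤ e′)

  IsQNR : ℤ → Set (c ⊔ ℓ)
  IsQNR n₀ = Σ ℕ λ e → IsExponent e × Coprime (ℤ.∣ n₀ ∣) e
                 × ¬ (∃[ x ] ((+ e) ∣ℤ (x ℤ.* x ℤ.- n₀)))

  -- Subsets D ⊆ G are boolean predicates respecting ≈.
  RespectsEq : (Carrier → Bool) → Set (c ⊔ ℓ)
  RespectsEq D = ∀ {a b} → a ≈ b → D a ≡ D b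

  -- coefficient of x^g in D(x^n) = Σ_{d ∈ D} x^{n d}
  coeffPow : (Carrier → Bool) → ℤ → Carrier → ℕ
  coeffPow D n g = count (λ d → D d ∧ ((n · d) == g))

  -- coefficient of x^g in D(x) D(x^n)
  coeffProd : (Carrier → Bool) → ℤ → Carrier → ℕ
  coeffProd D n g =
    foldr ℕ._+_ 0 (map (λ d → count (λ d′ → D d′ ∧ ((d ∙ (n · d′)) == g)))
                       (filterᵇ D elems))

  inScaled : (Carrier → Bool) → ℤ → Carrier → Bool
  inScaled D m h = any (λ d → D d ∧ ((m · d) == h)) elems

  k₀ : (Carrier → Bool) → ℤ → ℕ
  k₀ D n₀ = count (λ h → D h ∧ inScaled D (ℤ.- n₀) h)

  -- D is a GSHDS with respect to n₀:
  --   D(x) + D(x^{n₀}) = G(x) − [1]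
  --   D(x) D(x^{n₀}) = (k₀ − λ)[1] + λ G(x)   for some integer λ
  IsGSHDS : (Carrier → Bool) → ℤ → Set (c ⊔ ℓ)
  IsGSHDS D n₀ =
    RespectsEq D × IsQNR n₀ ×
    (∀ g → coeffPow D (+ 1) g ℕ.+ coeffPow D n₀ g ≡ (if g == ε then 0 else 1)) ×
    (∃[ λ′ ] ∀ g → + (coeffProd D n₀ g)
                   ≡ (if g == ε then (+ k₀ D n₀ ℤ.- λ′) ℤ.+ λ′ else λ′))

module _ {c ℓ r ℓr} (G : FinAbGroup c ℓ) (R : CommutativeRing r ℓr) where
  private
    module G = FinAbGroup G
    module R = CommutativeRing R

  record Character : Set (c ⊔ ℓ ⊔ r ⊔ ℓr) where
    field
      χ     : G.Carrier → R.Carrier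
      cong  : ∀ {a b} → a G.≈ b → χ a R.≈ χ b
      hom   : ∀ a b → χ (a G.∙ b) R.≈ (χ a R.* χ b)
      unit  : χ G.ε R.≈ R.1#

  NonPrincipal : Character → Set (c ⊔ ℓr)
  NonPrincipal ch = ∃[ g ] ¬ (Character.χ ch g R.≈ R.1#)

  charSum : Character → (G.Carrier → Bool) → R.Carrier
  charSum ch D = foldr R._+_ R.0# (map (Character.χ ch) (filterᵇ D G.elems))

fromℕ : ∀ {r ℓr} (R : CommutativeRing r ℓr) → ℕ → CommutativeRing.Carrier R
fromℕ R zero = CommutativeRing.0# R
fromℕ R (suc n) = CommutativeRing._+_ R (CommutativeRing.1# R) (fromℕ R n)

IsIntegralDomain : ∀ {r ℓr} → CommutativeRing r ℓr → Set (r ⊔ ℓr)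
IsIntegralDomain R = ¬ (1# ≈ 0#) × (∀ a b → (a * b) ≈ 0# → (a ≈ 0#) ⊎ (b ≈ 0#))
  where open CommutativeRing R

-- A non-principal character χ sums to zero over G, so applying it to the two group-ring
-- equations gives χ(D) + χ(D^{(n₀)}) = -1 and χ(D) χ(D^{(n₀)}) = k₀ - λ, whence
-- (2χ(D) + 1)² = 1 - 4(k₀ - λ). Applying the trivial character instead gives v = 2k + 1 and
-- k² = 2kλ + k₀, where λ ≥ 0 is a coefficient of D(x)D(x^{n₀}). As G is nontrivial, k ≠ 0,
-- so k = 2λ if k₀ = 0 and k = 2λ + 1 if k₀ = k; then 1 - 4(k₀ - λ) is v, respectively -v.

module Submission where

open import Defs
open import Algebra.Bundles using (CommutativeRing)
open import Data.Bool using (Bool; true; false; _∧_; if_then_else_)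
open import Data.Nat as ℕ using (ℕ; zero; suc)
open import Data.Integer as ℤ using (ℤ; +_)
open import Data.List using (List; []; _∷_; length; filterᵇ; map; foldr)
open import Data.List.Relation.Unary.Any using (Any; here; there)
open import Data.List.Relation.Unary.All as All using (All; []; _∷_)
open import Data.List.Relation.Unary.AllPairs using (AllPairs; []; _∷_)
open import Data.Empty using (⊥-elim)
open import Data.Product using (_×_; _,_; proj₁; proj₂)
open import Data.Sum using (_⊎_; inj₁; inj₂)
open import Relation.Nullary using (¬_; yes; no)
open import Relation.Nullary.Decidable using (dec-false)
open import Relation.Binary.PropositionalEquality as ≡ using (_≡_; _≢_)
import Data.Integer.Properties as ℤP
import Data.Nat.Properties as ℕP
import Data.Nat.Tactic.RingSolver as ℕSolver
import Data.Integer.Tactic.RingSolver as ℤSolver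

module ListSum {r ℓr} (R : CommutativeRing r ℓr) where
  open CommutativeRing R
  open import Relation.Binary.Reasoning.Setoid setoid
  open import Algebra.Properties.CommutativeSemigroup +-commutativeSemigroup using (interchange)

  ∑ : ∀ {a} {A : Set a} → List A → (A → Carrier) → Carrier
  ∑ xs f = foldr _+_ 0# (map f xs)

  syntax ∑ xs (λ x → e) = ∑[ x ∈ xs ] e

  infixl 7 _when_

  _when_ : Carrier → Bool → Carrier
  x when true  = x
  x when false = 0#

  when-cong : ∀ b {x y} → x ≈ y → x when b ≈ y when b
  when-cong true  x≈y = x≈y
  when-cong false _   = refl

  when-∧ : ∀ a b x → x when (a ∧ b) ≡ (x when b) when a
  when-∧ true  b x = ≡.refl
  when-∧ false b x = ≡.refl

  module _ {a} {A : Set a} where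

    sum-cong : ∀ xs {f g : A → Carrier} → (∀ x → f x ≈ g x) → ∑ xs f ≈ ∑ xs g
    sum-cong []       f≈g = refl
    sum-cong (x ∷ xs) f≈g = +-cong (f≈g x) (sum-cong xs f≈g)

    sum-zero : ∀ (xs : List A) → ∑[ _ ∈ xs ] 0# ≈ 0#
    sum-zero []       = refl
    sum-zero (x ∷ xs) = trans (+-identityˡ _) (sum-zero xs)

    sum-+ : ∀ xs (f g : A → Carrier) → ∑[ x ∈ xs ] (f x + g x) ≈ ∑ xs f + ∑ xs g
    sum-+ []       f g = sym (+-identityˡ 0#)
    sum-+ (x ∷ xs) f g = begin
      (f x + g x) + ∑[ x ∈ xs ] (f x + g x)   ≈⟨ +-congˡ (sum-+ xs f g) ⟩
      (f x + g x) + (∑ xs f + ∑ xs g)         ≈⟨ interchange _ _ _ _ ⟩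
      (f x + ∑ xs f) + (g x + ∑ xs g)         ∎

    sum-*ˡ : ∀ xs c (f : A → Carrier) → c * ∑ xs f ≈ ∑[ x ∈ xs ] (c * f x)
    sum-*ˡ []       c f = zeroʳ c
    sum-*ˡ (x ∷ xs) c f = trans (distribˡ c _ _) (+-congˡ (sum-*ˡ xs c f))

    sum-*ʳ : ∀ xs c (f : A → Carrier) → ∑ xs f * c ≈ ∑[ x ∈ xs ] (f x * c)
    sum-*ʳ xs c f = begin
      ∑ xs f * c            ≈⟨ *-comm _ c ⟩
      c * ∑ xs f            ≈⟨ sum-*ˡ xs c f ⟩
      ∑[ x ∈ xs ] (c * f x) ≈⟨ sum-cong xs (λ x → *-comm c (f x)) ⟩
      ∑[ x ∈ xs ] (f x * c) ∎

    sum-when : ∀ xs b (f : A → Carrier) → ∑[ x ∈ xs ] (f x when b) ≈ ∑ xs f when b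
    sum-when xs true  f = refl
    sum-when xs false f = sum-zero xs

    sum-filterᵇ : ∀ (p : A → Bool) xs (f : A → Carrier) →
                  ∑ (filterᵇ p xs) f ≈ ∑[ x ∈ xs ] (f x when p x)
    sum-filterᵇ p []       f = refl
    sum-filterᵇ p (x ∷ xs) f with p x
    ... | true  = +-congˡ (sum-filterᵇ p xs f)
    ... | false = trans (sum-filterᵇ p xs f) (sym (+-identityˡ _))

  sum-swap : ∀ {a b} {A : Set a} {B : Set b} (xs : List A) (ys : List B) (f : A → B → Carrier) →
             ∑[ x ∈ xs ] ∑ ys (f x) ≈ ∑[ y ∈ ys ] ∑[ x ∈ xs ] f x y
  sum-swap []       ys f = sym (sum-zero ys)
  sum-swap (x ∷ xs) ys f = begin
    ∑ ys (f x) + ∑[ x ∈ xs ] ∑ ys (f x)              ≈⟨ +-congˡ (sum-swap xs ys f) ⟩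
    ∑ ys (f x) + ∑[ y ∈ ys ] ∑[ x ∈ xs ] f x y       ≈⟨ sym (sum-+ ys (f x) _) ⟩
    ∑[ y ∈ ys ] (f x y + ∑[ x ∈ xs ] f x y)          ∎

  fromℕ-+ : ∀ m n → fromℕ R (m ℕ.+ n) ≈ fromℕ R m + fromℕ R n
  fromℕ-+ zero    n = sym (+-identityˡ _)
  fromℕ-+ (suc m) n = trans (+-congˡ (fromℕ-+ m n)) (sym (+-assoc _ _ _))

  fromℕ-1 : fromℕ R 1 ≈ 1#
  fromℕ-1 = +-identityʳ 1#

  fromℕ-double+1 : ∀ n → fromℕ R (n ℕ.+ n ℕ.+ 1) ≈ fromℕ R n + fromℕ R n + 1#
  fromℕ-double+1 n = trans (fromℕ-+ (n ℕ.+ n) 1) (+-cong (fromℕ-+ n n) fromℕ-1)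

  fromℕ-sum : ∀ {a} {A : Set a} (xs : List A) (f : A → ℕ) →
              fromℕ R (foldr ℕ._+_ 0 (map f xs)) ≈ ∑[ x ∈ xs ] fromℕ R (f x)
  fromℕ-sum []       f = refl
  fromℕ-sum (x ∷ xs) f = trans (fromℕ-+ (f x) _) (+-congˡ (fromℕ-sum xs f))

  fromℕ-count : ∀ {a} {A : Set a} (p : A → Bool) xs c →
                fromℕ R (length (filterᵇ p xs)) * c ≈ ∑[ x ∈ xs ] (c when p x)
  fromℕ-count p []       c = zeroˡ c
  fromℕ-count p (x ∷ xs) c with p x
  ... | true  = trans (distribʳ c 1# _) (+-cong (*-identityˡ c) (fromℕ-count p xs c))
  ... | false = trans (fromℕ-count p xs c) (sym (+-identityˡ _))

module Discriminant {r ℓr} (R : CommutativeRing r ℓr) where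
  open CommutativeRing R
  open import Relation.Binary.Reasoning.Setoid setoid
  open import Algebra.Solver.Ring.NaturalCoefficients.Default commutativeSemiring
  open import Algebra.Properties.Ring ring using (+-cancelʳ; +-inverseˡ-unique)

  quadruple : Carrier → Carrier
  quadruple z = (z + z) + (z + z)

  quadruple-cong : ∀ {a b} → a ≈ b → quadruple a ≈ quadruple b
  quadruple-cong a≈b = +-cong (+-cong a≈b a≈b) (+-cong a≈b a≈b)

  open ListSum R using (fromℕ-+; fromℕ-double+1)

  module _ {x y} (x+y+1≈0 : x + y + 1# ≈ 0#) where

    discriminant : ∀ M → (x + x + 1#) * (x + x + 1#) + quadruple (x * y + M) ≈ quadruple M + 1#
    discriminant M = begin
      (x + x + 1#) * (x + x + 1#) + quadruple (x * y + M) ≈⟨ expand x y M ⟩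
      quadruple x * (x + y + 1#) + (quadruple M + 1#)     ≈⟨ +-congʳ (trans (*-congˡ x+y+1≈0) (zeroʳ _)) ⟩
      0# + (quadruple M + 1#)                             ≈⟨ +-identityˡ _ ⟩
      quadruple M + 1#                                    ∎
      where
      expand : ∀ x y M → (x + x + 1#) * (x + x + 1#) + quadruple (x * y + M)
                         ≈ quadruple x * (x + y + 1#) + (quadruple M + 1#)
      expand = solve 3 (λ x y M →
        (x :+ x :+ con 1) :* (x :+ x :+ con 1) :+ (((x :* y :+ M) :+ (x :* y :+ M)) :+ ((x :* y :+ M) :+ (x :* y :+ M)))
        := ((x :+ x) :+ (x :+ x)) :* (x :+ y :+ con 1) :+ (((M :+ M) :+ (M :+ M)) :+ con 1)) refl

    discriminant-even : ∀ {M} → x * y + M ≈ 0# → (x + x + 1#) * (x + x + 1#) ≈ quadruple M + 1#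
    discriminant-even {M} xy+M≈0 = begin
      (x + x + 1#) * (x + x + 1#)                         ≈⟨ +-identityʳ _ ⟨
      (x + x + 1#) * (x + x + 1#) + 0#                    ≈⟨ +-congˡ quadruple[xy+M]≈0 ⟨
      (x + x + 1#) * (x + x + 1#) + quadruple (x * y + M) ≈⟨ discriminant M ⟩
      quadruple M + 1#                                    ∎
      where
      quadruple[xy+M]≈0 : quadruple (x * y + M) ≈ 0#
      quadruple[xy+M]≈0 = trans (quadruple-cong xy+M≈0)
        (trans (+-cong (+-identityʳ 0#) (+-identityʳ 0#)) (+-identityʳ 0#))

    discriminant-odd : ∀ {M} → x * y + M ≈ M + M + 1# →
                       (x + x + 1#) * (x + x + 1#) ≈ - ((M + M + 1#) + (M + M + 1#) + 1#)
    discriminant-odd {M} xy+M≈2M+1 = +-inverseˡ-unique _ _ (+-cancelʳ (quadruple M + 1#) _ _ (begin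
      Z + N + (quadruple M + 1#)         ≈⟨ +-assoc _ _ _ ⟩
      Z + (N + (quadruple M + 1#))       ≈⟨ +-congˡ (regroup M) ⟩
      Z + quadruple (M + M + 1#)         ≈⟨ +-congˡ (quadruple-cong xy+M≈2M+1) ⟨
      Z + quadruple (x * y + M)          ≈⟨ discriminant M ⟩
      quadruple M + 1#                   ≈⟨ +-identityˡ _ ⟨
      0# + (quadruple M + 1#)            ∎))
      where
      Z N : Carrier
      Z = (x + x + 1#) * (x + x + 1#)
      N = (M + M + 1#) + (M + M + 1#) + 1#
      regroup : ∀ M → (M + M + 1#) + (M + M + 1#) + 1# + (quadruple M + 1#) ≈ quadruple (M + M + 1#)
      regroup = solve 1 (λ M →
        (M :+ M :+ con 1) :+ (M :+ M :+ con 1) :+ con 1 :+ (((M :+ M) :+ (M :+ M)) :+ con 1)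
        := ((M :+ M :+ con 1) :+ (M :+ M :+ con 1)) :+ ((M :+ M :+ con 1) :+ (M :+ M :+ con 1))) refl

    discriminant≈2k+1 : ∀ {k m} → x * y + fromℕ R m ≈ 0# → k ≡ m ℕ.+ m →
                        (x + x + 1#) * (x + x + 1#) ≈ fromℕ R (k ℕ.+ k ℕ.+ 1)
    discriminant≈2k+1 {m = m} xy+M≈0 ≡.refl = begin
      (x + x + 1#) * (x + x + 1#)                        ≈⟨ discriminant-even xy+M≈0 ⟩
      quadruple (fromℕ R m) + 1#                         ≈⟨ +-congʳ (+-cong (fromℕ-+ m m) (fromℕ-+ m m)) ⟨
      fromℕ R (m ℕ.+ m) + fromℕ R (m ℕ.+ m) + 1#         ≈⟨ fromℕ-double+1 (m ℕ.+ m) ⟨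
      fromℕ R (m ℕ.+ m ℕ.+ (m ℕ.+ m) ℕ.+ 1)              ∎

    discriminant≈-[2k+1] : ∀ {k m} → x * y + fromℕ R m ≈ fromℕ R k → k ≡ m ℕ.+ m ℕ.+ 1 →
                        (x + x + 1#) * (x + x + 1#) ≈ - fromℕ R (k ℕ.+ k ℕ.+ 1)
    discriminant≈-[2k+1] {k} {m} xy+M≈K ≡.refl = begin
      (x + x + 1#) * (x + x + 1#)  ≈⟨ discriminant-odd (trans xy+M≈K (fromℕ-double+1 m)) ⟩
      - (N + N + 1#)               ≈⟨ -‿cong (+-congʳ (+-cong (fromℕ-double+1 m) (fromℕ-double+1 m))) ⟨
      - (K + K + 1#)               ≈⟨ -‿cong (fromℕ-double+1 k) ⟨
      - fromℕ R (k ℕ.+ k ℕ.+ 1)    ∎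
      where
      K N : Carrier
      K = fromℕ R k
      N = fromℕ R m + fromℕ R m + 1#

module GroupSums {c ℓ r ℓr} (G : FinAbGroup c ℓ) (R : CommutativeRing r ℓr) where
  open FinAbGroup G
    using (Carrier; _≈_; _∙_; ε; _⁻¹; _==_; _≟_; elems; complete; distinct; count)
    renaming (sym to ≈-sym; trans to ≈-trans)
  private module G = FinAbGroup G
  open CommutativeRing R
    renaming (Carrier to A; _≈_ to _≈ᴬ_)
  open ListSum R
  open import Relation.Binary.Reasoning.Setoid setoid
  open import Data.Bool using (T)
  open import Function using (_∘_)
  open import Data.List.Relation.Unary.All.Properties using (All¬⇒¬Any)
  open import Algebra.Properties.Group G.group using (y≈x\\z; \\-leftDividesˡ)

  ==-sound : ∀ {a b} → T (a == b) → a ≈ b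
  ==-sound {a} {b} with a ≟ b
  ... | yes a≈b = λ _ → a≈b
  ... | no  _   = λ ()

  ==-complete : ∀ {a b} → a ≈ b → T (a == b)
  ==-complete {a} {b} a≈b with a ≟ b
  ... | yes _   = _
  ... | no  a≉b = a≉b a≈b

  module _ (a : Carrier) (t : Carrier → Bool)
           (sound : ∀ g → T (t g) → a ≈ g) (complete-t : ∀ g → a ≈ g → T (t g))
           (f : Carrier → A) (f-cong : ∀ {g h} → g ≈ h → f g ≈ᴬ f h) where

    private
      sum-outside : ∀ xs → All (λ g → ¬ a ≈ g) xs → ∑[ g ∈ xs ] (f g when t g) ≈ᴬ 0#
      sum-outside []       []             = refl
      sum-outside (x ∷ xs) (a≉x ∷ a≉xs) with t x | sound x
      ... | true  | a≈x = ⊥-elim (a≉x (a≈x _))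
      ... | false | _   = trans (+-identityˡ _) (sum-outside xs a≉xs)

      apart : ∀ {x} xs → a ≈ x → All (λ g → ¬ x ≈ g) xs → All (λ g → ¬ a ≈ g) xs
      apart xs a≈x = All.map (λ x≉g a≈g → x≉g (≈-trans (≈-sym a≈x) a≈g))

      sum-inside : ∀ xs → Any (a ≈_) xs → AllPairs (λ g h → ¬ g ≈ h) xs →
                   ∑[ g ∈ xs ] (f g when t g) ≈ᴬ f a
      sum-inside (x ∷ xs) (here a≈x) (x≉xs ∷ _) with t x | complete-t x a≈x
      ... | true | _ = begin
        f x + ∑[ g ∈ xs ] (f g when t g) ≈⟨ +-congˡ (sum-outside xs (apart xs a≈x x≉xs)) ⟩
        f x + 0#                         ≈⟨ +-identityʳ _ ⟩
        f x                              ≈⟨ f-cong (≈-sym a≈x) ⟩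
        f a                              ∎
      sum-inside (x ∷ xs) (there a∈xs) (x≉xs ∷ xs-distinct) with t x | sound x
      ... | true  | a≈x = ⊥-elim (All¬⇒¬Any (apart xs (a≈x _) x≉xs) a∈xs)
      ... | false | _   = trans (+-identityˡ _) (sum-inside xs a∈xs xs-distinct)

    sum-indicator : ∑[ g ∈ elems ] (f g when t g) ≈ᴬ f a
    sum-indicator = sum-inside elems (complete a) distinct

  module _ (f : Carrier → A) (f-cong : ∀ {g h} → g ≈ h → f g ≈ᴬ f h) where

    sum-at : ∀ a → ∑[ g ∈ elems ] (f g when (a == g)) ≈ᴬ f a
    sum-at a = sum-indicator a (a ==_) (λ _ → ==-sound) (λ _ → ==-complete) f f-cong

    sum-at-ε : ∑[ g ∈ elems ] (f g when (g == ε)) ≈ᴬ f ε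
    sum-at-ε = sum-indicator ε (_== ε) (λ _ → ≈-sym ∘ ==-sound) (λ _ → ==-complete ∘ ≈-sym) f f-cong

  module _ (f : Carrier → A) (f-cong : ∀ {g h} → g ≈ h → f g ≈ᴬ f h) where

    sum-translate : ∀ h → ∑[ g ∈ elems ] f (h ∙ g) ≈ᴬ ∑ elems f
    sum-translate h = begin
      ∑[ g ∈ elems ] f (h ∙ g)                                   ≈⟨ sum-cong elems (λ g → sym (sum-at f f-cong (h ∙ g))) ⟩
      ∑[ g ∈ elems ] ∑[ g′ ∈ elems ] (f g′ when ((h ∙ g) == g′)) ≈⟨ sum-swap elems elems _ ⟩
      ∑[ g′ ∈ elems ] ∑[ g ∈ elems ] (f g′ when ((h ∙ g) == g′)) ≈⟨ sum-cong elems preimage ⟩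
      ∑ elems f                                                  ∎
      where
      preimage : ∀ g′ → ∑[ g ∈ elems ] (f g′ when ((h ∙ g) == g′)) ≈ᴬ f g′
      preimage g′ = sum-indicator (h ⁻¹ ∙ g′) (λ g → (h ∙ g) == g′)
        (λ g hg≈g′ → ≈-sym (y≈x\\z h g g′ (==-sound hg≈g′)))
        (λ g h\\g′≈g → ==-complete (≈-trans (G.∙-congˡ (≈-sym h\\g′≈g)) (\\-leftDividesˡ h g′)))
        (λ _ → f g′) (λ _ → refl)

    sum-fibres : ∀ (P : Carrier → Bool) (u : Carrier → Carrier) →
                 ∑[ g ∈ elems ] (fromℕ R (count (λ d → P d ∧ (u d == g))) * f g)
                   ≈ᴬ ∑[ d ∈ filterᵇ P elems ] f (u d)
    sum-fibres P u = begin
      ∑[ g ∈ elems ] (fromℕ R (count (λ d → P d ∧ (u d == g))) * f g)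
        ≈⟨ sum-cong elems (λ g → fromℕ-count _ elems (f g)) ⟩
      ∑[ g ∈ elems ] ∑[ d ∈ elems ] (f g when (P d ∧ (u d == g)))
        ≈⟨ sum-swap elems elems _ ⟩
      ∑[ d ∈ elems ] ∑[ g ∈ elems ] (f g when (P d ∧ (u d == g)))
        ≈⟨ sum-cong elems fibre ⟩
      ∑[ d ∈ elems ] (f (u d) when P d)
        ≈⟨ sum-filterᵇ P elems _ ⟨
      ∑[ d ∈ filterᵇ P elems ] f (u d) ∎
      where
      fibre : ∀ d → ∑[ g ∈ elems ] (f g when (P d ∧ (u d == g))) ≈ᴬ f (u d) when P d
      fibre d = begin
        ∑[ g ∈ elems ] (f g when (P d ∧ (u d == g)))   ≈⟨ sum-cong elems (λ g → reflexive (when-∧ (P d) _ (f g))) ⟩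
        ∑[ g ∈ elems ] ((f g when (u d == g)) when P d) ≈⟨ sum-when elems (P d) _ ⟩
        ∑[ g ∈ elems ] (f g when (u d == g)) when P d   ≈⟨ when-cong (P d) (sum-at f f-cong (u d)) ⟩
        f (u d) when P d                                ∎

    sum-if-ε : ∀ (c : Carrier → ℕ) a b → (∀ g → c g ≡ (if g == ε then a else b)) →
               ∑[ g ∈ elems ] (fromℕ R (c g) * f g) + fromℕ R b * f ε
                 ≈ᴬ fromℕ R b * ∑ elems f + fromℕ R a * f ε
    sum-if-ε c a b c≡ = begin
      ∑[ g ∈ elems ] (fromℕ R (c g) * f g) + fromℕ R b * f ε
        ≈⟨ +-congˡ (sum-at-ε′ b) ⟨
      ∑[ g ∈ elems ] (fromℕ R (c g) * f g) + ∑[ g ∈ elems ] (fromℕ R b * f g when (g == ε))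
        ≈⟨ sum-+ elems _ _ ⟨
      ∑[ g ∈ elems ] (fromℕ R (c g) * f g + fromℕ R b * f g when (g == ε))
        ≈⟨ sum-cong elems split ⟩
      ∑[ g ∈ elems ] (fromℕ R b * f g + fromℕ R a * f g when (g == ε))
        ≈⟨ sum-+ elems _ _ ⟩
      ∑[ g ∈ elems ] (fromℕ R b * f g) + ∑[ g ∈ elems ] (fromℕ R a * f g when (g == ε))
        ≈⟨ +-cong (sym (sum-*ˡ elems (fromℕ R b) f)) (sum-at-ε′ a) ⟩
      fromℕ R b * ∑ elems f + fromℕ R a * f ε ∎
      where
      sum-at-ε′ : ∀ n → ∑[ g ∈ elems ] (fromℕ R n * f g when (g == ε)) ≈ᴬ fromℕ R n * f ε
      sum-at-ε′ n = sum-at-ε (λ g → fromℕ R n * f g) (λ g≈h → *-congˡ (f-cong g≈h))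
      split : ∀ g → fromℕ R (c g) * f g + fromℕ R b * f g when (g == ε)
                      ≈ᴬ fromℕ R b * f g + fromℕ R a * f g when (g == ε)
      split g rewrite c≡ g with g == ε
      ... | true  = +-comm _ _
      ... | false = refl

module CharacterSums {c ℓ r ℓr} (G : FinAbGroup c ℓ) (R : CommutativeRing r ℓr)
                     (ch : Character G R) where
  open FinAbGroup G using (Carrier; _≈_; _∙_; ε; _·_; _==_; elems; coeffPow; coeffProd; identityʳ)
  open CommutativeRing R renaming (Carrier to A; _≈_ to _≈ᴬ_)
  open Character ch renaming (cong to χ-cong)
  open ListSum R
  open GroupSums G R
  open import Relation.Binary.Reasoning.Setoid setoid
  open import Algebra.Properties.Ring ring using (-‿distribˡ-*; +-inverseˡ-unique; -‿involutive)

  scaledCharSum : (Carrier → Bool) → ℤ → A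
  scaledCharSum D n = ∑[ d ∈ filterᵇ D elems ] χ (n · d)

  χ-shift : ∀ h → χ h * ∑ elems χ ≈ᴬ ∑ elems χ
  χ-shift h = begin
    χ h * ∑ elems χ            ≈⟨ sum-*ˡ elems (χ h) χ ⟩
    ∑[ g ∈ elems ] (χ h * χ g) ≈⟨ sum-cong elems (λ g → hom h g) ⟨
    ∑[ g ∈ elems ] χ (h ∙ g)   ≈⟨ sum-translate χ χ-cong h ⟩
    ∑ elems χ                  ∎

  sum-χ≈0 : (∀ a b → a * b ≈ᴬ 0# → a ≈ᴬ 0# ⊎ b ≈ᴬ 0#) → ∀ {h} → ¬ χ h ≈ᴬ 1# → ∑ elems χ ≈ᴬ 0#
  sum-χ≈0 no-zero-divisors {h} χh≉1 with no-zero-divisors (χ h - 1#) (∑ elems χ) annihilates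
    where
    annihilates : (χ h - 1#) * ∑ elems χ ≈ᴬ 0#
    annihilates = begin
      (χ h - 1#) * ∑ elems χ               ≈⟨ distribʳ _ _ _ ⟩
      χ h * ∑ elems χ + - 1# * ∑ elems χ   ≈⟨ +-cong (χ-shift h) (sym (-‿distribˡ-* 1# _)) ⟩
      ∑ elems χ + - (1# * ∑ elems χ)       ≈⟨ +-congˡ (-‿cong (*-identityˡ _)) ⟩
      ∑ elems χ - ∑ elems χ                ≈⟨ -‿inverseʳ _ ⟩
      0#                                   ∎
  ... | inj₁ χh-1≈0 = ⊥-elim (χh≉1 (trans (+-inverseˡ-unique _ _ χh-1≈0) (-‿involutive 1#)))
  ... | inj₂ sum≈0  = sum≈0

  sum-coeffPow : ∀ D n → ∑[ g ∈ elems ] (fromℕ R (coeffPow D n g) * χ g)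
                           ≈ᴬ scaledCharSum D n
  sum-coeffPow D n = sum-fibres χ χ-cong D (n ·_)

  sum-coeffProd : ∀ D n → ∑[ g ∈ elems ] (fromℕ R (coeffProd D n g) * χ g)
                            ≈ᴬ charSum G R ch D * scaledCharSum D n
  sum-coeffProd D n = begin
    ∑[ g ∈ elems ] (fromℕ R (coeffProd D n g) * χ g)
      ≈⟨ sum-cong elems (λ g → trans (*-congʳ (fromℕ-sum FD _)) (sum-*ʳ FD (χ g) _)) ⟩
    ∑[ g ∈ elems ] ∑[ d ∈ FD ] (fromℕ R (fibre d g) * χ g)
      ≈⟨ sum-swap elems FD _ ⟩
    ∑[ d ∈ FD ] ∑[ g ∈ elems ] (fromℕ R (fibre d g) * χ g)
      ≈⟨ sum-cong FD (λ d → sum-fibres χ χ-cong D (λ d′ → d ∙ (n · d′))) ⟩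
    ∑[ d ∈ FD ] ∑[ d′ ∈ FD ] χ (d ∙ (n · d′))
      ≈⟨ sum-cong FD (λ d → sum-cong FD (λ d′ → hom d (n · d′))) ⟩
    ∑[ d ∈ FD ] ∑[ d′ ∈ FD ] (χ d * χ (n · d′))
      ≈⟨ sum-cong FD (λ d → sum-*ˡ FD (χ d) _) ⟨
    ∑[ d ∈ FD ] (χ d * ∑[ d′ ∈ FD ] χ (n · d′))
      ≈⟨ sum-*ʳ FD _ χ ⟨
    ∑ FD χ * ∑[ d ∈ FD ] χ (n · d) ∎
    where
    FD : List Carrier
    FD = filterᵇ D elems
    fibre : Carrier → Carrier → ℕ
    fibre d g = FinAbGroup.count G (λ d′ → D d′ ∧ ((d ∙ (n · d′)) == g))

  fromℕ*χε : ∀ n → fromℕ R n * χ ε ≈ᴬ fromℕ R n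
  fromℕ*χε n = trans (*-congˡ unit) (*-identityʳ _)

  module _ (D : Carrier → Bool) (n₀ : ℤ) where

    sum-law : (∀ g → coeffPow D (+ 1) g ℕ.+ coeffPow D n₀ g ≡ (if g == ε then 0 else 1)) →
              charSum G R ch D + scaledCharSum D n₀ + 1# ≈ᴬ ∑ elems χ
    sum-law sums = begin
      charSum G R ch D + scaledCharSum D n₀ + 1#
        ≈⟨ +-cong (+-cong (sum-cong FD (λ d → χ-cong (identityʳ d))) refl) (trans (fromℕ*χε 1) fromℕ-1) ⟨
      scaledCharSum D (+ 1) + scaledCharSum D n₀ + fromℕ R 1 * χ ε
        ≈⟨ +-congʳ (+-cong (sum-coeffPow D (+ 1)) (sum-coeffPow D n₀)) ⟨
      ∑[ g ∈ elems ] (fromℕ R (coeffPow D (+ 1) g) * χ g) + ∑[ g ∈ elems ] (fromℕ R (coeffPow D n₀ g) * χ g)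
        + fromℕ R 1 * χ ε
        ≈⟨ +-congʳ (sum-+ elems _ _) ⟨
      ∑[ g ∈ elems ] (fromℕ R (coeffPow D (+ 1) g) * χ g + fromℕ R (coeffPow D n₀ g) * χ g)
        + fromℕ R 1 * χ ε
        ≈⟨ +-congʳ (sum-cong elems λ g → trans (*-congʳ (fromℕ-+ (coeffPow D (+ 1) g) _)) (distribʳ _ _ _)) ⟨
      ∑[ g ∈ elems ] (fromℕ R (coeffPow D (+ 1) g ℕ.+ coeffPow D n₀ g) * χ g) + fromℕ R 1 * χ ε
        ≈⟨ sum-if-ε χ χ-cong _ 0 1 sums ⟩
      fromℕ R 1 * ∑ elems χ + fromℕ R 0 * χ ε
        ≈⟨ +-cong (*-congʳ fromℕ-1) (zeroˡ _) ⟩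
      1# * ∑ elems χ + 0#
        ≈⟨ trans (+-identityʳ _) (*-identityˡ _) ⟩
      ∑ elems χ ∎
      where
      FD : List Carrier
      FD = filterᵇ D elems

    product-law : ∀ k₀ m → (∀ g → coeffProd D n₀ g ≡ (if g == ε then k₀ else m)) →
                  charSum G R ch D * scaledCharSum D n₀ + fromℕ R m
                    ≈ᴬ fromℕ R m * ∑ elems χ + fromℕ R k₀
    product-law k₀ m products = begin
      charSum G R ch D * scaledCharSum D n₀ + fromℕ R m
        ≈⟨ +-cong (sum-coeffProd D n₀) (fromℕ*χε m) ⟨
      ∑[ g ∈ elems ] (fromℕ R (coeffProd D n₀ g) * χ g) + fromℕ R m * χ ε
        ≈⟨ sum-if-ε χ χ-cong _ k₀ m products ⟩
      fromℕ R m * ∑ elems χ + fromℕ R k₀ * χ ε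
        ≈⟨ +-congˡ (fromℕ*χε k₀) ⟩
      fromℕ R m * ∑ elems χ + fromℕ R k₀ ∎

    module _ (total≈0 : ∑ elems χ ≈ᴬ 0#) where

      product-law₀ : ∀ k₀ m → (∀ g → coeffProd D n₀ g ≡ (if g == ε then k₀ else m)) →
                     charSum G R ch D * scaledCharSum D n₀ + fromℕ R m ≈ᴬ fromℕ R k₀
      product-law₀ k₀ m products = begin
        charSum G R ch D * scaledCharSum D n₀ + fromℕ R m ≈⟨ product-law k₀ m products ⟩
        fromℕ R m * ∑ elems χ + fromℕ R k₀               ≈⟨ +-congʳ (*-congˡ total≈0) ⟩
        fromℕ R m * 0# + fromℕ R k₀                      ≈⟨ +-congʳ (zeroʳ _) ⟩
        0# + fromℕ R k₀                                  ≈⟨ +-identityˡ _ ⟩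
        fromℕ R k₀                                       ∎

module FinAbGroupProperties {c ℓ} (G : FinAbGroup c ℓ) where
  open FinAbGroup G

  order≡1⇒trivial : order ≡ 1 → ∀ a b → a ≈ b
  order≡1⇒trivial order≡1 a b = singleton elems order≡1 (complete a) (complete b)
    where
    singleton : ∀ xs → length xs ≡ 1 → Any (a ≈_) xs → Any (b ≈_) xs → a ≈ b
    singleton (_ ∷ []) _ (here a≈x) (here b≈x) = trans a≈x (sym b≈x)

  module _ (D : Carrier → Bool) (n₀ : ℤ) where

    coeffProd-off-ε : ∀ {h} → ¬ h ≈ ε → ∀ λ′ →
      (∀ g → + coeffProd D n₀ g ≡ (if g == ε then (+ k₀ D n₀ ℤ.- λ′) ℤ.+ λ′ else λ′)) →
      ∀ g → coeffProd D n₀ g ≡ (if g == ε then k₀ D n₀ else coeffProd D n₀ h)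
    coeffProd-off-ε {h} h≉ε λ′ products g with g == ε | products g
    ... | true  | at-ε  = ℤP.+-injective (≡.trans at-ε (i-j+j≡i (+ k₀ D n₀) λ′))
      where
      i-j+j≡i : ∀ i j → (i ℤ.- j) ℤ.+ j ≡ i
      i-j+j≡i = ℤSolver.solve-∀
    ... | false | off-ε = ℤP.+-injective (≡.trans off-ε (≡.sym at-h))
      where
      at-h : + coeffProd D n₀ h ≡ λ′
      at-h with h == ε | products h | dec-false (h ≟ ε) h≉ε
      ... | .false | off-ε-h | ≡.refl = off-ε-h

square-law⇒k : ∀ k m k₀ .{{_ : ℕ.NonZero k}} → k ℕ.* k ℕ.+ m ≡ m ℕ.* (k ℕ.+ k ℕ.+ 1) ℕ.+ k₀ →
               (k₀ ≡ 0 → k ≡ m ℕ.+ m) × (k₀ ≡ k → k ≡ m ℕ.+ m ℕ.+ 1)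
square-law⇒k k m k₀ square = even , odd
  where
  open ℕP using (+-cancelʳ-≡; *-cancelʳ-≡; +-identityʳ)
  regroup : ∀ k m k₀ → m ℕ.* (k ℕ.+ k ℕ.+ 1) ℕ.+ k₀ ≡ (m ℕ.+ m) ℕ.* k ℕ.+ k₀ ℕ.+ m
  regroup = ℕSolver.solve-∀
  k²≡2mk+k₀ : k ℕ.* k ≡ (m ℕ.+ m) ℕ.* k ℕ.+ k₀
  k²≡2mk+k₀ = +-cancelʳ-≡ m _ _ (≡.trans square (regroup k m k₀))
  even : k₀ ≡ 0 → k ≡ m ℕ.+ m
  even ≡.refl = *-cancelʳ-≡ k (m ℕ.+ m) k (≡.trans k²≡2mk+k₀ (+-identityʳ _))
  odd : k₀ ≡ k → k ≡ m ℕ.+ m ℕ.+ 1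
  odd ≡.refl = *-cancelʳ-≡ k (m ℕ.+ m ℕ.+ 1) k (≡.trans k²≡2mk+k₀ (absorb k m))
    where
    absorb : ∀ k m → (m ℕ.+ m) ℕ.* k ℕ.+ k ≡ (m ℕ.+ m ℕ.+ 1) ℕ.* k
    absorb = ℕSolver.solve-∀

module Counting {c ℓ} (G : FinAbGroup c ℓ) (D : FinAbGroup.Carrier G → Bool) (n₀ : ℤ) where
  open FinAbGroup G using (_≈_; ε; _==_; elems; order; count; coeffPow; coeffProd; k₀)
  open FinAbGroupProperties G using (order≡1⇒trivial)
  open ListSum ℤP.+-*-commutativeRing
  open ≡.≡-Reasoning

  trivialCharacter : Character G ℤP.+-*-commutativeRing
  trivialCharacter = record
    { χ = λ _ → + 1 ; cong = λ _ → ≡.refl ; hom = λ _ _ → ≡.refl ; unit = ≡.refl }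

  open CharacterSums G ℤP.+-*-commutativeRing trivialCharacter

  sum-ones : ∀ {a} {A : Set a} (xs : List A) → ∑[ _ ∈ xs ] (+ 1) ≡ + length xs
  sum-ones []       = ≡.refl
  sum-ones (_ ∷ xs) = ≡.cong ℤ.suc (sum-ones xs)

  fromℕ-ℤ : ∀ n → fromℕ ℤP.+-*-commutativeRing n ≡ + n
  fromℕ-ℤ zero    = ≡.refl
  fromℕ-ℤ (suc n) = ≡.cong ℤ.suc (fromℕ-ℤ n)

  order-law : (∀ g → coeffPow D (+ 1) g ℕ.+ coeffPow D n₀ g ≡ (if g == ε then 0 else 1)) →
              order ≡ count D ℕ.+ count D ℕ.+ 1
  order-law sums = ℤP.+-injective (begin
    + order
      ≡⟨ sum-ones elems ⟨
    ∑[ _ ∈ elems ] (+ 1)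
      ≡⟨ sum-law D n₀ sums ⟨
    charSum G _ trivialCharacter D ℤ.+ scaledCharSum D n₀ ℤ.+ + 1
      ≡⟨ ≡.cong₂ (λ a b → a ℤ.+ b ℤ.+ + 1) (sum-ones (filterᵇ D elems)) (sum-ones (filterᵇ D elems)) ⟩
    + (count D ℕ.+ count D ℕ.+ 1) ∎)

  square-law : ∀ m → (∀ g → coeffProd D n₀ g ≡ (if g == ε then k₀ D n₀ else m)) →
               count D ℕ.* count D ℕ.+ m ≡ m ℕ.* order ℕ.+ k₀ D n₀
  square-law m products = ℤP.+-injective (begin
    + (count D ℕ.* count D) ℤ.+ + m
      ≡⟨ ≡.cong₂ ℤ._+_ (ℤP.pos-* (count D) (count D)) (≡.sym (fromℕ-ℤ m)) ⟩
    + count D ℤ.* + count D ℤ.+ fromℕ _ m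
      ≡⟨ ≡.cong (λ a → a ℤ.* a ℤ.+ fromℕ _ m) (sum-ones (filterᵇ D elems)) ⟨
    charSum G _ trivialCharacter D ℤ.* scaledCharSum D n₀ ℤ.+ fromℕ _ m
      ≡⟨ product-law D n₀ (k₀ D n₀) m products ⟩
    fromℕ _ m ℤ.* ∑[ _ ∈ elems ] (+ 1) ℤ.+ fromℕ _ (k₀ D n₀)
      ≡⟨ ≡.cong₂ (λ a b → a ℤ.* b ℤ.+ fromℕ _ (k₀ D n₀)) (fromℕ-ℤ m) (sum-ones elems) ⟩
    + m ℤ.* + order ℤ.+ fromℕ _ (k₀ D n₀)
      ≡⟨ ≡.cong₂ ℤ._+_ (≡.sym (ℤP.pos-* m order)) (fromℕ-ℤ (k₀ D n₀)) ⟩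
    + (m ℕ.* order ℕ.+ k₀ D n₀) ∎)

  k-parameters : ∀ {h} → ¬ h ≈ ε →
    (∀ g → coeffPow D (+ 1) g ℕ.+ coeffPow D n₀ g ≡ (if g == ε then 0 else 1)) →
    ∀ m → (∀ g → coeffProd D n₀ g ≡ (if g == ε then k₀ D n₀ else m)) →
    (k₀ D n₀ ≡ 0 → count D ≡ m ℕ.+ m) × (k₀ D n₀ ≡ count D → count D ≡ m ℕ.+ m ℕ.+ 1)
  k-parameters {h} h≉ε sums m products =
    square-law⇒k (count D) m (k₀ D n₀) {{ℕ.≢-nonZero k≢0}}
      (≡.subst (λ v → count D ℕ.* count D ℕ.+ m ≡ m ℕ.* v ℕ.+ k₀ D n₀) (order-law sums) (square-law m products))
    where
    k≢0 : count D ≢ 0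
    k≢0 k≡0 = h≉ε (order≡1⇒trivial (≡.trans (order-law sums) (≡.cong (λ k → k ℕ.+ k ℕ.+ 1) k≡0)) h ε)

corollary4 : ∀ {c ℓ r ℓr} (G : FinAbGroup c ℓ) (R : CommutativeRing r ℓr)
    → IsIntegralDomain R
    → (D : FinAbGroup.Carrier G → Bool) (n₀ : ℤ)
    → FinAbGroup.IsGSHDS G D n₀
    → (ch : Character G R) → NonPrincipal G R ch
    → let open CommutativeRing R
          x = charSum G R ch D
          v = FinAbGroup.order G
          k = FinAbGroup.count G D
          k₀ = FinAbGroup.k₀ G D n₀
      in (k₀ ≡ 0 → ((x + x + 1#) * (x + x + 1#)) ≈ fromℕ R v)
         × (k₀ ≡ k → ((x + x + 1#) * (x + x + 1#)) ≈ - fromℕ R v)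
corollary4 G R (_ , no-zero-divisors) D n₀ (_ , _ , sums , λ′ , products) ch (h , χh≉1) =
  square≈v , square≈-v
  where
  open FinAbGroup G using (_≈_; ε; _==_; elems; order; count; coeffProd; k₀)
  open CommutativeRing R hiding (_≈_) renaming (Carrier to A)
  open CommutativeRing R using () renaming (_≈_ to _≈ᴿ_)
  open Character ch renaming (cong to χ-cong)
  open CharacterSums G R ch
  open Counting G D n₀
  open Discriminant R
  open ListSum R using (∑)

  x y : A
  x = charSum G R ch D
  y = scaledCharSum D n₀

  h≉ε : ¬ h ≈ ε
  h≉ε h≈ε = χh≉1 (trans (χ-cong h≈ε) unit)

  m : ℕ
  m = coeffProd D n₀ h

  products′ : ∀ g → coeffProd D n₀ g ≡ (if g == ε then k₀ D n₀ else m)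
  products′ = FinAbGroupProperties.coeffProd-off-ε G D n₀ h≉ε λ′ products

  total≈0 : ∑ elems χ ≈ᴿ 0#
  total≈0 = sum-χ≈0 no-zero-divisors χh≉1

  x+y+1≈0 : x + y + 1# ≈ᴿ 0#
  x+y+1≈0 = trans (sum-law D n₀ sums) total≈0

  xy+m≈k₀ : ∀ {n} → k₀ D n₀ ≡ n → x * y + fromℕ R m ≈ᴿ fromℕ R n
  xy+m≈k₀ ≡.refl = product-law₀ D n₀ total≈0 (k₀ D n₀) m products′

  v≈ : fromℕ R (count D ℕ.+ count D ℕ.+ 1) ≈ᴿ fromℕ R order
  v≈ = reflexive (≡.cong (fromℕ R) (≡.sym (order-law sums)))

  square≈v : k₀ D n₀ ≡ 0 → (x + x + 1#) * (x + x + 1#) ≈ᴿ fromℕ R order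
  square≈v k₀≡0 = trans (discriminant≈2k+1 x+y+1≈0 {m = m} (xy+m≈k₀ k₀≡0)
                           (proj₁ (k-parameters h≉ε sums m products′) k₀≡0)) v≈

  square≈-v : k₀ D n₀ ≡ count D → (x + x + 1#) * (x + x + 1#) ≈ᴿ - fromℕ R order
  square≈-v k₀≡k = trans (discriminant≈-[2k+1] x+y+1≈0 {m = m} (xy+m≈k₀ k₀≡k)
                            (proj₂ (k-parameters h≉ε sums m products′) k₀≡k)) (-‿cong v≈)
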